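{- Let $n\ge 6$ be an integer. In $\mathbb{Z}/n\mathbb{Z}$ let $A=\mathbb{Z}/n\mathbb{Z}\setminus\{0,1,3\}$ and $B=\mathbb{Z}/n\mathbb{Z}\setminus\{0,1,2\}$. Then, for all nonnegative integers $w_0,w_1,w_3$, the number of matchings $f:A\to B$ with $|\{a\in A: a+f(a)=0\}|=w_0$, $|\{a\in A: a+f(a)=1\}|=w_1$ and $|\{a\in A: a+f(a)=3\}|=w_3$ equals $\binom{w_0+w_1}{w_1}$ if $w_0+w_1+w_3=n-3$ and $2w_0+w_1+1=w_3+2$, and equals $0$ otherwise. Equivalently, the generating function $\sum_f c_0^{w_0(f)}c_1^{w_1(f)}c_3^{w_3(f)}$ over all matchings $f$ equals $$\sum_{\substack{w_0 + w_1 + w_3 = n-3 \\ 2w_0 + w_1 + 1 = w_3+2}} \binom{w_0+w_1}{w_1} c_0^{w_0} c_1^{w_1} c_3^{w_3},$$ the sum being over nonnegative integers $w_0,w_1,w_3$.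
   Context: For an abelian group $(G,+)$ and nonempty finite subsets $A,B\subseteq G$, a matching from $A$ to $B$ is a bijection $f:A\to B$ such that $a+f(a)\notin A$ for all $a\in A$. Here $0,1,2,3$ denote residue classes modulo $n$, and for a matching $f$, $w_k(f)=|\{a\in A: a+f(a)=k\}|$ for $k\in\{0,1,3\}$; $c_0,c_1,c_3$ are commuting indeterminates. -}

module Defs where

open import Data.Nat using (ℕ; zero; suc; _+_)
open import Data.Nat.DivMod using (_%_; m%n<n)
open import Data.Fin using (Fin; toℕ; fromℕ<)
open import Data.Fin.Properties using (_≟_)
open import Data.List using (List; length; filter; allFin)
open import Data.Vec using (Vec; lookup; fromList)
open import Data.Product using (_×_; ∃)
open import Relation.Nullary using (¬_)
open import Relation.Binary.PropositionalEquality using (_≡_; _≢_)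
import Data.Nat.Properties as ℕP

_⊕_ : ∀ {n} → Fin n → Fin n → Fin n
_⊕_ {suc m} a b = fromℕ< (m%n<n (toℕ a + toℕ b) (suc m))

InA : ∀ {n} → Fin n → Set
InA x = (toℕ x ≢ 0) × (toℕ x ≢ 1) × (toℕ x ≢ 3)

InB : ∀ {n} → Fin n → Set
InB x = (toℕ x ≢ 0) × (toℕ x ≢ 1) × (toℕ x ≢ 2)

listA : (n : ℕ) → List (Fin n)
listA n = filter (λ x → notIn x) (allFin n)
  where
  open import Relation.Nullary.Decidable using (¬?; _×-dec_)
  notIn : (x : Fin n) → _
  notIn x = ¬? (toℕ x ℕP.≟ 0) ×-dec ¬? (toℕ x ℕP.≟ 1) ×-dec ¬? (toℕ x ℕP.≟ 3)

sizeA : ℕ → ℕ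
sizeA n = length (listA n)

elA : (n : ℕ) → Fin (sizeA n) → Fin n
elA n i = lookup (fromList (listA n)) i

-- A map f : A → B is encoded by the vector of its values
-- (f (elA n i) = lookup v i).
Map : ℕ → Set
Map n = Vec (Fin n) (sizeA n)

IsMatching : (n : ℕ) → Map n → Set
IsMatching n v =
  (∀ i → InB (lookup v i)) ×
  (∀ i j → lookup v i ≡ lookup v j → i ≡ j) ×
  (∀ (b : Fin n) → InB b → ∃ λ i → lookup v i ≡ b) ×
  (∀ i → ¬ InA (elA n i ⊕ lookup v i))

weight : (n : ℕ) → ℕ → Map n → ℕ
weight n k v = length (filter (λ i → toℕ (elA n i ⊕ lookup v i) ℕP.≟ k) (allFin (sizeA n)))

module Submission where

-- For a matching f and a ∈ A, the sum a + f(a) ≥ 2 + 3 exceeds every allowed residue, so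
-- a + f(a) = n + dₐ with a digit dₐ ∈ {0, 1, 3}.  The matching is thus determined by its word of
-- digits, and it is a bijection onto B exactly when the images a − dₐ = n − f(a) run through
-- 1, …, n − 3 once each.  Listing A as 2, 4, 5, …, n − 1, the element at index s ≥ 1 is s + 3, so
-- a block 1 3 swaps two consecutive images and a block 0 3 3 rotates three of them.  Looking at
-- where the smallest value not yet hit comes from shows that the valid words are exactly 1 T and
-- 0 3 T with T a word in these two blocks.  Such a T with j blocks 1 3 and k blocks 0 3 3 has
-- weights (k, j, j + 2k), and there are C(j + k, j) of them; Pascal's rule adds the two leading
-- cases up to C(w₀ + w₁, w₁).

open import Defs
open import Data.Nat using (ℕ; zero; suc; _+_; _*_; _∸_; _≤_; _<_; s≤s; z≤n; _≟_; _≤?_; _%_; NonZero)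
open import Data.Nat.Properties
open import Data.Nat.DivMod using (_mod_; m≤n⇒[n∸m]%m≡n%m; m<n⇒m%n≡m; [m+n]%n≡m%n)
open import Data.Nat.Combinatorics using (_C_; nCn≡1; nCk+nC[k+1]≡[n+1]C[k+1])
open import Data.Nat.Tactic.RingSolver using (solve-∀)
open import Data.Bool using (true; false)
open import Data.Empty using (⊥; ⊥-elim)
open import Data.Product using (_×_; _,_; ∃; ∃₂; proj₁; proj₂)
open import Data.Sum using (inj₁; inj₂)
open import Data.Fin using (Fin; zero; suc; toℕ; cast; fromℕ<; _↑ʳ_)
open import Data.Fin.Properties using (toℕ-cast; toℕ-fromℕ<; toℕ<n; toℕ-injective)
import Data.Vec as Vec
import Data.Vec.Properties as Vec using (tabulate-cong; tabulate∘lookup; lookup∘tabulate)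
open import Data.List as List using (List; []; _∷_; length; [_]; map; _++_; tabulate)
open import Data.List.Properties
  using ( length-map; length-++; length-tabulate; tabulate-cong; filter-all; map-tabulate; map-∘
        ; map-id-local)
open import Data.List.Membership.Propositional using (_∈_)
open import Data.List.Membership.Propositional.Properties
  using (∈-∃++; ∈-tabulate⁺; ∈-tabulate⁻; ∈-map⁺; ∈-map⁻; ∈-++⁺ˡ; ∈-++⁺ʳ; ∈-++⁻)
open import Data.List.Relation.Unary.Any using (here; there)
open import Data.List.Relation.Unary.All as All using (All; []; _∷_)
open import Data.List.Relation.Unary.All.Properties using (tabulate⁺; tabulate⁻)
open import Data.List.Relation.Unary.AllPairs using ([]; _∷_)
open import Data.List.Relation.Unary.Unique.Propositional using (Unique)
import Data.List.Relation.Unary.Unique.Propositional.Properties as Unique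
open import Data.List.Relation.Binary.Permutation.Propositional
  using (_↭_; ↭-refl; ↭-prep; ↭-swap; ↭-trans; ↭-sym; ↭⇒↭ₛ)
open import Data.List.Relation.Binary.Permutation.Propositional.Properties
  using (∈-resp-↭; drop-∷; shift)
import Data.List.Relation.Binary.Permutation.Setoid.Properties as SetoidPermutation
open import Function using (_∘_; id)
open import Function.Bundles using (_⇔_; mk⇔)
open import Relation.Nullary using (¬_; Dec; does; yes; no)
open import Relation.Nullary.Decidable using (_×-dec_)
open import Relation.Unary using (Decidable)
open import Relation.Binary.PropositionalEquality
  using (_≡_; _≢_; ≢-sym; refl; sym; trans; cong; cong₂; subst; subst₂; setoid; module ≡-Reasoning)
open ≡-Reasoning

-- Duplicate-free lists and permutations

Unique-resp-↭ : ∀ {A : Set} {xs ys : List A} → xs ↭ ys → Unique xs → Unique ys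
Unique-resp-↭ {A} σ = SetoidPermutation.Unique-resp-↭ (setoid A) (↭⇒↭ₛ σ)

unique-⊆⊇⇒↭ : ∀ {A : Set} {xs ys : List A} → Unique xs → Unique ys →
  (∀ {z} → z ∈ xs → z ∈ ys) → (∀ {z} → z ∈ ys → z ∈ xs) → xs ↭ ys
unique-⊆⊇⇒↭ {xs = []} {[]} _ _ _ _ = ↭-refl
unique-⊆⊇⇒↭ {xs = []} {_ ∷ _} _ _ _ ys⊆xs with () ← ys⊆xs (here refl)
unique-⊆⊇⇒↭ {xs = x ∷ xs} (x∉xs ∷ xs!) ys! xs⊆ys ys⊆xs
  with as , bs , refl ← ∈-∃++ (xs⊆ys (here refl))
  with x∉rest ∷ rest! ← Unique-resp-↭ (shift x as bs) ys!
  = ↭-trans (↭-prep x (unique-⊆⊇⇒↭ xs! rest! ⊆rest rest⊆)) (↭-sym (shift x as bs))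
  where
  ⊆rest : ∀ {z} → z ∈ xs → z ∈ as ++ bs
  ⊆rest z∈xs with ∈-resp-↭ (shift x as bs) (xs⊆ys (there z∈xs))
  ... | here z≡x = ⊥-elim (All.lookup x∉xs z∈xs (sym z≡x))
  ... | there z∈rest = z∈rest
  rest⊆ : ∀ {z} → z ∈ as ++ bs → z ∈ xs
  rest⊆ z∈rest with ys⊆xs (∈-resp-↭ (↭-sym (shift x as bs)) (there z∈rest))
  ... | here z≡x = ⊥-elim (All.lookup x∉rest z∈rest (sym z≡x))
  ... | there z∈xs = z∈xs

drop-swapped : ∀ {A : Set} {x y : A} {xs ys} → y ∷ x ∷ xs ↭ x ∷ y ∷ ys → xs ↭ ys
drop-swapped σ = drop-∷ (drop-∷ (↭-trans (↭-swap _ _ ↭-refl) σ))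

drop-rotated : ∀ {A : Set} {x y z : A} {xs ys} →
  z ∷ x ∷ y ∷ xs ↭ x ∷ y ∷ z ∷ ys → xs ↭ ys
drop-rotated σ =
  drop-∷ (drop-∷ (drop-∷ (↭-trans σ (↭-trans (↭-prep _ (↭-swap _ _ ↭-refl)) (↭-swap _ _ ↭-refl)))))

interval : ℕ → ℕ → List ℕ
interval a zero = []
interval a (suc l) = a ∷ interval (suc a) l

∈-interval⁻ : ∀ {a l c} → c ∈ interval a l → a ≤ c × c < a + l
∈-interval⁻ {a} {suc l} (here refl) = ≤-refl , m<m+n a (s≤s z≤n)
∈-interval⁻ {a} {suc l} (there c∈) with a<c , c<a+1+l ← ∈-interval⁻ c∈ =
  <⇒≤ a<c , ≤-trans c<a+1+l (≤-reflexive (sym (+-suc a l)))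

∈-interval⁺ : ∀ {a l c} → a ≤ c → c < a + l → c ∈ interval a l
∈-interval⁺ {a} {zero} a≤c c<a+0 = ⊥-elim (<⇒≱ c<a+0 (≤-trans (≤-reflexive (+-identityʳ a)) a≤c))
∈-interval⁺ {a} {suc l} a≤c c<a+1+l with m≤n⇒m<n∨m≡n a≤c
... | inj₂ refl = here refl
... | inj₁ a<c = there (∈-interval⁺ a<c (≤-trans c<a+1+l (≤-reflexive (+-suc a l))))

interval-unique : ∀ a l → Unique (interval a l)
interval-unique a zero = []
interval-unique a (suc l) =
  All.tabulate (λ c∈ → <⇒≢ (proj₁ (∈-interval⁻ c∈))) ∷ interval-unique (suc a) l

length-filter-map : ∀ {A B : Set} {P : B → Set} (P? : Decidable P) (f : A → B) xs →
  length (List.filter P? (map f xs)) ≡ length (List.filter (P? ∘ f) xs)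
length-filter-map P? f [] = refl
length-filter-map P? f (x ∷ xs) with does (P? (f x))
... | true = cong suc (length-filter-map P? f xs)
... | false = length-filter-map P? f xs

tabulate-unique⇒injective : ∀ {A : Set} {n} {f : Fin n → A} →
  Unique (tabulate f) → ∀ {i j} → f i ≡ f j → i ≡ j
tabulate-unique⇒injective (_ ∷ _) {zero} {zero} _ = refl
tabulate-unique⇒injective (f₀∉ ∷ _) {zero} {suc j} f₀≡ = ⊥-elim (All.lookup f₀∉ (∈-tabulate⁺ j) f₀≡)
tabulate-unique⇒injective (f₀∉ ∷ _) {suc i} {zero} fᵢ≡ = ⊥-elim (All.lookup f₀∉ (∈-tabulate⁺ i) (sym fᵢ≡))
tabulate-unique⇒injective (_ ∷ u) {suc i} {suc j} fᵢ≡ = cong suc (tabulate-unique⇒injective u fᵢ≡)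

-- Out of range, nth returns the junk value 0.
nth : List ℕ → ℕ → ℕ
nth [] _ = 0
nth (x ∷ xs) zero = x
nth (x ∷ xs) (suc i) = nth xs i

nth-tabulate : ∀ {n} (f : Fin n → ℕ) i → nth (tabulate f) (toℕ i) ≡ f i
nth-tabulate f zero = refl
nth-tabulate f (suc i) = nth-tabulate (f ∘ suc) i

tabulate-nth : ∀ {n} xs → length xs ≡ n → tabulate (λ (i : Fin n) → nth xs (toℕ i)) ≡ xs
tabulate-nth [] refl = refl
tabulate-nth (x ∷ xs) refl = cong (x ∷_) (tabulate-nth xs refl)

lookup-fromList-tabulate : ∀ {A : Set} {n} (f : Fin n → A) (i : Fin (length (tabulate f))) →
  Vec.lookup (Vec.fromList (tabulate f)) i ≡ f (cast (length-tabulate f) i)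
lookup-fromList-tabulate {n = suc n} f zero = refl
lookup-fromList-tabulate {n = suc n} f (suc i) = lookup-fromList-tabulate (f ∘ suc) i

-- Digit words whose images permute an interval

data Digit : ℕ → Set where
  digit0 : Digit 0
  digit1 : Digit 1
  digit3 : Digit 3

digit≤3 : ∀ {d} → Digit d → d ≤ 3
digit≤3 digit0 = z≤n
digit≤3 digit1 = s≤s z≤n
digit≤3 digit3 = ≤-refl

-- Index 0 of A holds 2 and index s ≥ 1 holds s + 3; imagesFrom s lists the values a − dₐ for
-- digits dₐ placed from index s on.
imagesFrom : ℕ → List ℕ → List ℕ
imagesFrom s [] = []
imagesFrom s (d ∷ ds) = 3 + s ∸ d ∷ imagesFrom (suc s) ds

images : List ℕ → List ℕ
images [] = []
images (d ∷ ds) = 2 ∸ d ∷ imagesFrom 1 ds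

position : ℕ → ℕ
position zero = 2
position (suc i) = 4 + i

imagesFrom-tabulate : ∀ s {n} (f : Fin n → ℕ) →
  imagesFrom s (tabulate f) ≡ tabulate (λ i → 3 + (s + toℕ i) ∸ f i)
imagesFrom-tabulate s {zero} f = refl
imagesFrom-tabulate s {suc n} f =
  cong₂ _∷_ (cong (λ x → 3 + x ∸ f zero) (sym (+-identityʳ s)))
    (trans (imagesFrom-tabulate (suc s) (f ∘ suc))
           (tabulate-cong (λ i → cong (λ x → 3 + x ∸ f (suc i)) (sym (+-suc s (toℕ i))))))

images-tabulate : ∀ {n} (f : Fin n → ℕ) →
  images (tabulate f) ≡ tabulate (λ i → position (toℕ i) ∸ f i)
images-tabulate {zero} f = refl
images-tabulate {suc n} f = cong (2 ∸ f zero ∷_) (imagesFrom-tabulate 1 (f ∘ suc))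

Valid : List ℕ → Set
Valid ds = All Digit ds × images ds ↭ interval 1 (length ds)

data Tiling : List ℕ → ℕ → ℕ → Set where
  []    : Tiling [] 0 0
  13∷_  : ∀ {t j k} → Tiling t j k → Tiling (1 ∷ 3 ∷ t) (suc j) k
  033∷_ : ∀ {t j k} → Tiling t j k → Tiling (0 ∷ 3 ∷ 3 ∷ t) j (suc k)

data Admissible : List ℕ → Set where
  1∷_  : ∀ {t j k} → Tiling t j k → Admissible (1 ∷ t)
  03∷_ : ∀ {t j k} → Tiling t j k → Admissible (0 ∷ 3 ∷ t)

tiling-digits : ∀ {t j k} → Tiling t j k → All Digit t
tiling-digits [] = []
tiling-digits (13∷ τ) = digit1 ∷ digit3 ∷ tiling-digits τ
tiling-digits (033∷ τ) = digit0 ∷ digit3 ∷ digit3 ∷ tiling-digits τ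

tiling-images-↭ : ∀ s {t j k} → Tiling t j k → imagesFrom s t ↭ interval (suc s) (length t)
tiling-images-↭ s [] = ↭-refl
tiling-images-↭ s (13∷ τ) = ↭-swap (2 + s) (1 + s) (tiling-images-↭ (2 + s) τ)
tiling-images-↭ s (033∷ τ) =
  ↭-trans (↭-swap (3 + s) (1 + s) ↭-refl)
          (↭-prep (1 + s) (↭-swap (3 + s) (2 + s) (tiling-images-↭ (3 + s) τ)))

admissible⇒valid : ∀ {ds} → Admissible ds → Valid ds
admissible⇒valid (1∷ τ) = digit1 ∷ tiling-digits τ , ↭-prep 1 (tiling-images-↭ 1 τ)
admissible⇒valid (03∷ τ) = digit0 ∷ digit3 ∷ tiling-digits τ , ↭-swap 2 1 (tiling-images-↭ 2 τ)

imagesFrom-≥ : ∀ {s t c} → All Digit t → c ∈ imagesFrom s t → s ≤ c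
imagesFrom-≥ {s} (digit0 ∷ _) (here refl) = m≤n+m s 3
imagesFrom-≥ {s} (digit1 ∷ _) (here refl) = m≤n+m s 2
imagesFrom-≥ (digit3 ∷ _) (here refl) = ≤-refl
imagesFrom-≥ (_ ∷ δs) (there c∈) = <⇒≤ (imagesFrom-≥ δs c∈)

index-preimage : ∀ {s t} → All Digit t → s ∈ imagesFrom s t → ∃ λ t′ → t ≡ 3 ∷ t′
index-preimage (digit0 ∷ _) (here s≡) = ⊥-elim (m≢1+n+m _ s≡)
index-preimage (digit1 ∷ _) (here s≡) = ⊥-elim (m≢1+n+m _ s≡)
index-preimage (digit3 ∷ _) (here _) = _ , refl
index-preimage (_ ∷ δs) (there s∈) = ⊥-elim (1+n≰n (imagesFrom-≥ δs s∈))

successor-preimage : ∀ {s d t} → All Digit (d ∷ t) → suc s ∈ imagesFrom s (d ∷ t) →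
  ∃ λ t′ → t ≡ 3 ∷ t′
successor-preimage (digit0 ∷ _) (here 1+s≡) = ⊥-elim (m≢1+n+m _ (suc-injective 1+s≡))
successor-preimage (digit1 ∷ _) (here 1+s≡) = ⊥-elim (m≢1+n+m _ (suc-injective 1+s≡))
successor-preimage (digit3 ∷ _) (here 1+s≡) = ⊥-elim (m≢1+n+m _ (sym 1+s≡))
successor-preimage (_ ∷ δs) (there 1+s∈) = index-preimage δs 1+s∈

-- The value s + 1 can only come from index s + 1 with digit 3.  So the digit at s cannot be 3
-- (its value s is too small), a 1 there closes the block 1 3, and a 0 (value s + 3) forces also
-- s + 2 to come from index s + 2 with digit 3, closing the block 0 3 3.
images-↭⇒tiling : ∀ s {t} → All Digit t → imagesFrom s t ↭ interval (suc s) (length t) →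
  ∃₂ (Tiling t)
images-↭⇒tiling s [] _ = 0 , 0 , []
images-↭⇒tiling s δs@(_ ∷ _) σ with successor-preimage δs (∈-resp-↭ (↭-sym σ) (here refl))
images-↭⇒tiling s (digit3 ∷ _) σ | _ = ⊥-elim (1+n≰n (proj₁ (∈-interval⁻ (∈-resp-↭ σ (here refl)))))
images-↭⇒tiling s (digit1 ∷ δs) σ | _ , refl
  with j , k , τ ← images-↭⇒tiling (2 + s) (All.tail δs) (drop-swapped σ) = suc j , k , 13∷ τ
images-↭⇒tiling s (digit0 ∷ δs) σ | _ , refl with ∈-resp-↭ (↭-sym σ) (there (here refl))
... | here 2+s≡3+s = ⊥-elim (m≢1+n+m (2 + s) {0} 2+s≡3+s)
... | there 2+s∈ with _ , refl ← successor-preimage δs 2+s∈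
  with j , k , τ ← images-↭⇒tiling (3 + s) (All.tail (All.tail δs)) (drop-rotated σ) =
  j , suc k , 033∷ τ

valid⇒admissible : ∀ {ds} → 0 < length ds → Valid ds → Admissible ds
valid⇒admissible () ([] , _)
valid⇒admissible _ (digit3 ∷ _ , σ) = ⊥-elim (1+n≰n (proj₁ (∈-interval⁻ (∈-resp-↭ σ (here refl)))))
valid⇒admissible _ (digit1 ∷ δs , σ) with _ , _ , τ ← images-↭⇒tiling 1 δs (drop-∷ σ) = 1∷ τ
valid⇒admissible _ (digit0 ∷ δs , σ) with ∈-resp-↭ (↭-sym σ) (here refl)
... | there 1∈ with _ , refl ← index-preimage δs 1∈
  with _ , _ , τ ← images-↭⇒tiling 2 (All.tail δs) (drop-swapped σ) = 03∷ τ

-- Weights and enumeration of tilings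

count : ℕ → List ℕ → ℕ
count k ds = length (List.filter (_≟ k) ds)

count-digits : ∀ {ds} → All Digit ds → count 0 ds + count 1 ds + count 3 ds ≡ length ds
count-digits [] = refl
count-digits (digit0 ∷ δs) = cong suc (count-digits δs)
count-digits {_ ∷ ds} (digit1 ∷ δs) =
  trans (cong (_+ count 3 ds) (+-suc (count 0 ds) (count 1 ds))) (cong suc (count-digits δs))
count-digits {_ ∷ ds} (digit3 ∷ δs) =
  trans (+-suc (count 0 ds + count 1 ds) (count 3 ds)) (cong suc (count-digits δs))

tiling-counts : ∀ {t j k} → Tiling t j k → count 0 t ≡ k × count 1 t ≡ j
tiling-counts [] = refl , refl
tiling-counts (13∷ τ) with c₀ , c₁ ← tiling-counts τ = c₀ , cong suc c₁
tiling-counts (033∷ τ) with c₀ , c₁ ← tiling-counts τ = cong suc c₀ , c₁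

tiling-balance : ∀ {t j k} → Tiling t j k → count 3 t ≡ count 1 t + 2 * count 0 t
tiling-balance [] = refl
tiling-balance (13∷ τ) = cong suc (tiling-balance τ)
tiling-balance {0 ∷ 3 ∷ 3 ∷ t} (033∷ τ) =
  trans (cong (2 +_) (tiling-balance τ)) (rearrange (count 1 t) (count 0 t))
  where
  rearrange : ∀ c₁ c₀ → 2 + (c₁ + 2 * c₀) ≡ c₁ + 2 * suc c₀
  rearrange = solve-∀

admissible-balance : ∀ {ds} → Admissible ds → 2 * count 0 ds + count 1 ds + 1 ≡ count 3 ds + 2
admissible-balance {1 ∷ t} (1∷ τ) =
  trans (rearrange (count 0 t) (count 1 t)) (cong (_+ 2) (sym (tiling-balance τ)))
  where
  rearrange : ∀ c₀ c₁ → 2 * c₀ + suc c₁ + 1 ≡ c₁ + 2 * c₀ + 2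
  rearrange = solve-∀
admissible-balance {0 ∷ 3 ∷ t} (03∷ τ) =
  trans (rearrange (count 0 t) (count 1 t)) (cong (λ c₃ → suc c₃ + 2) (sym (tiling-balance τ)))
  where
  rearrange : ∀ c₀ c₁ → 2 * suc c₀ + c₁ + 1 ≡ suc (c₁ + 2 * c₀) + 2
  rearrange = solve-∀

prepend13 prepend033 : List ℕ → List ℕ
prepend13 t = 1 ∷ 3 ∷ t
prepend033 t = 0 ∷ 3 ∷ 3 ∷ t

tilings : ℕ → ℕ → List (List ℕ)
tilings zero zero = [ [] ]
tilings (suc j) zero = map prepend13 (tilings j zero)
tilings zero (suc k) = map prepend033 (tilings zero k)
tilings (suc j) (suc k) = map prepend13 (tilings j (suc k)) ++ map prepend033 (tilings (suc j) k)

∈-tilings⁻ : ∀ {t} j k → t ∈ tilings j k → Tiling t j k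
∈-tilings⁻ zero zero (here refl) = []
∈-tilings⁻ (suc j) zero t∈ with _ , t′∈ , refl ← ∈-map⁻ prepend13 t∈ = 13∷ ∈-tilings⁻ j zero t′∈
∈-tilings⁻ zero (suc k) t∈ with _ , t′∈ , refl ← ∈-map⁻ prepend033 t∈ = 033∷ ∈-tilings⁻ zero k t′∈
∈-tilings⁻ (suc j) (suc k) t∈ with ∈-++⁻ (map prepend13 (tilings j (suc k))) t∈
... | inj₁ t∈₁₃ with _ , t′∈ , refl ← ∈-map⁻ prepend13 t∈₁₃ = 13∷ ∈-tilings⁻ j (suc k) t′∈
... | inj₂ t∈₀₃₃ with _ , t′∈ , refl ← ∈-map⁻ prepend033 t∈₀₃₃ = 033∷ ∈-tilings⁻ (suc j) k t′∈

∈-tilings⁺ : ∀ {t j k} → Tiling t j k → t ∈ tilings j k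
∈-tilings⁺ [] = here refl
∈-tilings⁺ (13∷_ {k = zero} τ) = ∈-map⁺ prepend13 (∈-tilings⁺ τ)
∈-tilings⁺ (13∷_ {k = suc k} τ) = ∈-++⁺ˡ (∈-map⁺ prepend13 (∈-tilings⁺ τ))
∈-tilings⁺ (033∷_ {j = zero} τ) = ∈-map⁺ prepend033 (∈-tilings⁺ τ)
∈-tilings⁺ (033∷_ {j = suc j} τ) =
  ∈-++⁺ʳ (map prepend13 (tilings j _)) (∈-map⁺ prepend033 (∈-tilings⁺ τ))

prepend13-injective : ∀ {t t′} → prepend13 t ≡ prepend13 t′ → t ≡ t′
prepend13-injective refl = refl

prepend033-injective : ∀ {t t′} → prepend033 t ≡ prepend033 t′ → t ≡ t′
prepend033-injective refl = refl

tilings-unique : ∀ j k → Unique (tilings j k)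
tilings-unique zero zero = [] ∷ []
tilings-unique (suc j) zero = Unique.map⁺ prepend13-injective (tilings-unique j zero)
tilings-unique zero (suc k) = Unique.map⁺ prepend033-injective (tilings-unique zero k)
tilings-unique (suc j) (suc k) =
  Unique.++⁺ (Unique.map⁺ prepend13-injective (tilings-unique j (suc k)))
             (Unique.map⁺ prepend033-injective (tilings-unique (suc j) k))
             disjoint
  where
  disjoint : ∀ {xs ys t} → t ∈ map prepend13 xs × t ∈ map prepend033 ys → ⊥
  disjoint (t∈₁₃ , t∈₀₃₃)
    with _ , _ , refl ← ∈-map⁻ prepend13 t∈₁₃ with _ , _ , () ← ∈-map⁻ prepend033 t∈₀₃₃

[n+0]Cn≡1 : ∀ n → (n + 0) C n ≡ 1
[n+0]Cn≡1 n = trans (cong (_C n) (+-identityʳ n)) (nCn≡1 n)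

length-tilings : ∀ j k → length (tilings j k) ≡ (j + k) C j
length-tilings zero zero = refl
length-tilings (suc j) zero = begin
  length (map prepend13 (tilings j zero)) ≡⟨ length-map prepend13 (tilings j zero) ⟩
  length (tilings j zero)                 ≡⟨ length-tilings j zero ⟩
  (j + 0) C j                             ≡⟨ trans ([n+0]Cn≡1 j) (sym ([n+0]Cn≡1 (suc j))) ⟩
  (suc j + 0) C suc j                     ∎
length-tilings zero (suc k) = trans (length-map prepend033 (tilings zero k)) (length-tilings zero k)
length-tilings (suc j) (suc k) = begin
  length (map prepend13 (tilings j (suc k)) ++ map prepend033 (tilings (suc j) k))
    ≡⟨ length-++ (map prepend13 (tilings j (suc k))) ⟩
  length (map prepend13 (tilings j (suc k))) + length (map prepend033 (tilings (suc j) k))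
    ≡⟨ cong₂ _+_ (length-map prepend13 (tilings j (suc k)))
                 (length-map prepend033 (tilings (suc j) k)) ⟩
  length (tilings j (suc k)) + length (tilings (suc j) k)
    ≡⟨ cong₂ _+_ (length-tilings j (suc k)) (length-tilings (suc j) k) ⟩
  (j + suc k) C j + (suc j + k) C suc j
    ≡⟨ cong (λ n → n C j + (suc j + k) C suc j) (+-suc j k) ⟩
  (suc j + k) C j + (suc j + k) C suc j
    ≡⟨ nCk+nC[k+1]≡[n+1]C[k+1] (suc j + k) j ⟩
  suc (suc j + k) C suc j
    ≡⟨ cong (λ n → suc n C suc j) (+-suc j k) ⟨
  (suc j + suc k) C suc j ∎

prepend03 prepend1 : List ℕ → List ℕ
prepend03 t = 0 ∷ 3 ∷ t
prepend1 t = 1 ∷ t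

admissibles : ℕ → ℕ → List (List ℕ)
admissibles zero zero = []
admissibles zero (suc j) = map prepend1 (tilings j zero)
admissibles (suc k) zero = map prepend03 (tilings zero k)
admissibles (suc k) (suc j) = map prepend03 (tilings (suc j) k) ++ map prepend1 (tilings j (suc k))

∈-prepend03⁻ : ∀ {ds j k} → ds ∈ map prepend03 (tilings j k) →
  Admissible ds × count 0 ds ≡ suc k × count 1 ds ≡ j
∈-prepend03⁻ {j = j} {k} ds∈ with _ , t∈ , refl ← ∈-map⁻ prepend03 ds∈
  with τ ← ∈-tilings⁻ j k t∈ with c₀ , c₁ ← tiling-counts τ = 03∷ τ , cong suc c₀ , c₁

∈-prepend1⁻ : ∀ {ds j k} → ds ∈ map prepend1 (tilings j k) →
  Admissible ds × count 0 ds ≡ k × count 1 ds ≡ suc j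
∈-prepend1⁻ {j = j} {k} ds∈ with _ , t∈ , refl ← ∈-map⁻ prepend1 ds∈
  with τ ← ∈-tilings⁻ j k t∈ with c₀ , c₁ ← tiling-counts τ = 1∷ τ , c₀ , cong suc c₁

∈-admissibles⁻ : ∀ {ds} w₀ w₁ → ds ∈ admissibles w₀ w₁ →
  Admissible ds × count 0 ds ≡ w₀ × count 1 ds ≡ w₁
∈-admissibles⁻ zero (suc j) ds∈ = ∈-prepend1⁻ ds∈
∈-admissibles⁻ (suc k) zero ds∈ = ∈-prepend03⁻ ds∈
∈-admissibles⁻ (suc k) (suc j) ds∈ with ∈-++⁻ (map prepend03 (tilings (suc j) k)) ds∈
... | inj₁ ds∈₀₃ = ∈-prepend03⁻ ds∈₀₃
... | inj₂ ds∈₁ = ∈-prepend1⁻ ds∈₁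

∈-admissibles⁺ : ∀ {ds} → Admissible ds → ds ∈ admissibles (count 0 ds) (count 1 ds)
∈-admissibles⁺ {1 ∷ t} (1∷ τ) with c₀ , c₁ ← tiling-counts τ =
  subst₂ (λ w₀ w₁ → 1 ∷ t ∈ admissibles w₀ w₁) (sym c₀) (cong suc (sym c₁)) (leading1 τ)
  where
  leading1 : ∀ {t j k} → Tiling t j k → 1 ∷ t ∈ admissibles k (suc j)
  leading1 {k = zero} τ = ∈-map⁺ prepend1 (∈-tilings⁺ τ)
  leading1 {j = j} {suc k} τ =
    ∈-++⁺ʳ (map prepend03 (tilings (suc j) k)) (∈-map⁺ prepend1 (∈-tilings⁺ τ))
∈-admissibles⁺ {0 ∷ 3 ∷ t} (03∷ τ) with c₀ , c₁ ← tiling-counts τ =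
  subst₂ (λ w₀ w₁ → 0 ∷ 3 ∷ t ∈ admissibles w₀ w₁) (cong suc (sym c₀)) (sym c₁) (leading03 τ)
  where
  leading03 : ∀ {t j k} → Tiling t j k → 0 ∷ 3 ∷ t ∈ admissibles (suc k) j
  leading03 {j = zero} τ = ∈-map⁺ prepend03 (∈-tilings⁺ τ)
  leading03 {j = suc j} τ = ∈-++⁺ˡ (∈-map⁺ prepend03 (∈-tilings⁺ τ))

prepend03-injective : ∀ {t t′} → prepend03 t ≡ prepend03 t′ → t ≡ t′
prepend03-injective refl = refl

prepend1-injective : ∀ {t t′} → prepend1 t ≡ prepend1 t′ → t ≡ t′
prepend1-injective refl = refl

admissibles-unique : ∀ w₀ w₁ → Unique (admissibles w₀ w₁)
admissibles-unique zero zero = []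
admissibles-unique zero (suc j) = Unique.map⁺ prepend1-injective (tilings-unique j zero)
admissibles-unique (suc k) zero = Unique.map⁺ prepend03-injective (tilings-unique zero k)
admissibles-unique (suc k) (suc j) =
  Unique.++⁺ (Unique.map⁺ prepend03-injective (tilings-unique (suc j) k))
             (Unique.map⁺ prepend1-injective (tilings-unique j (suc k)))
             disjoint
  where
  disjoint : ∀ {xs ys ds} → ds ∈ map prepend03 xs × ds ∈ map prepend1 ys → ⊥
  disjoint (ds∈₀₃ , ds∈₁)
    with _ , _ , refl ← ∈-map⁻ prepend03 ds∈₀₃ with _ , _ , () ← ∈-map⁻ prepend1 ds∈₁

length-admissibles : ∀ w₀ w₁ → 0 < w₀ + w₁ → length (admissibles w₀ w₁) ≡ (w₀ + w₁) C w₁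
length-admissibles zero (suc j) _ = begin
  length (map prepend1 (tilings j zero)) ≡⟨ length-map prepend1 (tilings j zero) ⟩
  length (tilings j zero)                ≡⟨ length-tilings j zero ⟩
  (j + 0) C j                            ≡⟨ trans ([n+0]Cn≡1 j) (sym (nCn≡1 (suc j))) ⟩
  suc j C suc j                          ∎
length-admissibles (suc k) zero _ = trans (length-map prepend03 (tilings zero k)) (length-tilings zero k)
length-admissibles (suc k) (suc j) _ = begin
  length (map prepend03 (tilings (suc j) k) ++ map prepend1 (tilings j (suc k)))
    ≡⟨ length-++ (map prepend03 (tilings (suc j) k)) ⟩
  length (map prepend03 (tilings (suc j) k)) + length (map prepend1 (tilings j (suc k)))
    ≡⟨ cong₂ _+_ (length-map prepend03 (tilings (suc j) k))
                 (length-map prepend1 (tilings j (suc k))) ⟩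
  length (tilings (suc j) k) + length (tilings j (suc k))
    ≡⟨ cong₂ _+_ (length-tilings (suc j) k) (length-tilings j (suc k)) ⟩
  (suc j + k) C suc j + (j + suc k) C j
    ≡⟨ +-comm ((suc j + k) C suc j) _ ⟩
  (j + suc k) C j + (suc j + k) C suc j
    ≡⟨ cong (λ n → n C j + (suc j + k) C suc j) (+-suc j k) ⟩
  (suc j + k) C j + (suc j + k) C suc j
    ≡⟨ nCk+nC[k+1]≡[n+1]C[k+1] (suc j + k) j ⟩
  suc (suc j + k) C suc j
    ≡⟨ cong (λ n → suc n C suc j) (+-comm (suc j) k) ⟩
  suc (k + suc j) C suc j ∎

-- Matchings of ℤ/nℤ

not-A⇒digit : ∀ d → ¬ (d ≢ 0 × d ≢ 1 × d ≢ 3) → Digit d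
not-A⇒digit 0 _ = digit0
not-A⇒digit 1 _ = digit1
not-A⇒digit 2 notA = ⊥-elim (notA ((λ ()) , (λ ()) , (λ ())))
not-A⇒digit 3 _ = digit3
not-A⇒digit (suc (suc (suc (suc d)))) notA = ⊥-elim (notA ((λ ()) , (λ ()) , (λ ())))

digit⇒not-A : ∀ {d} → Digit d → ¬ (d ≢ 0 × d ≢ 1 × d ≢ 3)
digit⇒not-A digit0 (d≢0 , _) = d≢0 refl
digit⇒not-A digit1 (_ , d≢1 , _) = d≢1 refl
digit⇒not-A digit3 (_ , _ , d≢3) = d≢3 refl

B⇒3≤ : ∀ {b} → b ≢ 0 × b ≢ 1 × b ≢ 2 → 3 ≤ b
B⇒3≤ {0} (b≢0 , _) = ⊥-elim (b≢0 refl)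
B⇒3≤ {1} (_ , b≢1 , _) = ⊥-elim (b≢1 refl)
B⇒3≤ {2} (_ , _ , b≢2) = ⊥-elim (b≢2 refl)
B⇒3≤ {suc (suc (suc b))} _ = s≤s (s≤s (s≤s z≤n))

3≤⇒B : ∀ {b} → 3 ≤ b → b ≢ 0 × b ≢ 1 × b ≢ 2
3≤⇒B (s≤s (s≤s (s≤s _))) = (λ ()) , (λ ()) , (λ ())

[m+n]%o+o≡m+n : ∀ {m n o} .{{_ : NonZero o}} → m < o → n < o → o ≤ m + n →
  (m + n) % o + o ≡ m + n
[m+n]%o+o≡m+n {m} {n} {o} m<o n<o o≤m+n = begin
  (m + n) % o + o     ≡⟨ cong (_+ o) (m≤n⇒[n∸m]%m≡n%m o≤m+n) ⟨
  (m + n ∸ o) % o + o ≡⟨ cong (_+ o) (m<n⇒m%n≡m m+n∸o<o) ⟩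
  m + n ∸ o + o       ≡⟨ m∸n+n≡m o≤m+n ⟩
  m + n               ∎
  where
  m+n∸o<o : m + n ∸ o < o
  m+n∸o<o = subst (m + n ∸ o <_) (m+n∸n≡m o o) (∸-monoˡ-< (+-mono-< m<o n<o) o≤m+n)

m∸[m+n]%o≡o∸n : ∀ {m n o} .{{_ : NonZero o}} → 2 ≤ m → 3 ≤ n → m < o → n < o →
  Digit ((m + n) % o) → m ∸ (m + n) % o ≡ o ∸ n
m∸[m+n]%o≡o∸n {m} {n} {o} 2≤m 3≤n m<o n<o δ with o ≤? m + n
... | no o≰m+n = ⊥-elim (<⇒≱ (≤-trans (n≤1+n 4) (+-mono-≤ 2≤m 3≤n))
                   (subst (_≤ 3) (m<n⇒m%n≡m (≰⇒> o≰m+n)) (digit≤3 δ)))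
... | yes o≤m+n = begin
  m ∸ d                ≡⟨ [m+n]∸[m+o]≡n∸o n m d ⟨
  (n + m) ∸ (n + d)    ≡⟨ cong₂ _∸_ (+-comm n m) (+-comm n d) ⟩
  (m + n) ∸ (d + n)    ≡⟨ cong (_∸ (d + n)) ([m+n]%o+o≡m+n m<o n<o o≤m+n) ⟨
  (d + o) ∸ (d + n)    ≡⟨ [m+n]∸[m+o]≡n∸o d o n ⟩
  o ∸ n                ∎
  where
  d : ℕ
  d = (m + n) % o

-- Everything below only needs n = 4 + k ≥ 4.
module Matchings (k : ℕ) where

  N : ℕ
  N = 4 + k

  listA-≡ : listA N ≡ suc (suc zero) ∷ tabulate (4 ↑ʳ_)
  listA-≡ = cong (suc (suc zero) ∷_) (filter-all _ (tabulate⁺ (λ _ → (λ ()) , (λ ()) , (λ ()))))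

  sizeA-≡ : sizeA N ≡ suc k
  sizeA-≡ = trans (cong length listA-≡) (cong suc (length-tabulate _))

  toℕ-elA : ∀ i → toℕ (elA N i) ≡ position (toℕ i)
  toℕ-elA = toℕ-lookup listA-≡
    where
    -- Generalising over the list lets the pattern refl also rewrite the index type Fin (length xs).
    toℕ-lookup : ∀ {xs} → xs ≡ suc (suc zero) ∷ tabulate (4 ↑ʳ_) →
      ∀ (i : Fin (length xs)) → toℕ (Vec.lookup (Vec.fromList xs) i) ≡ position (toℕ i)
    toℕ-lookup refl zero = refl
    toℕ-lookup refl (suc i) =
      trans (cong toℕ (lookup-fromList-tabulate (4 ↑ʳ_) i)) (cong (4 +_) (toℕ-cast _ i))

  toℕ<1+k : ∀ (i : Fin (sizeA N)) → toℕ i < suc k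
  toℕ<1+k i = subst (toℕ i <_) sizeA-≡ (toℕ<n i)

  position-bounds : ∀ {i} → i < suc k → 2 ≤ position i × position i < N
  position-bounds {zero} _ = ≤-refl , s≤s (s≤s (s≤s z≤n))
  position-bounds {suc i} (s≤s i<k) = s≤s (s≤s z≤n) , +-monoʳ-< 4 i<k

  complement-∈-interval : ∀ {b} → 3 ≤ b → b < N → N ∸ b ∈ interval 1 (suc k)
  complement-∈-interval 3≤b b<N = ∈-interval⁺ (m<n⇒0<n∸m b<N) (s≤s (∸-monoʳ-≤ N 3≤b))

  ∈-interval⇒complement : ∀ {c} → c ∈ interval 1 (suc k) →
    N ∸ c < N × 3 ≤ N ∸ c × N ∸ (N ∸ c) ≡ c
  ∈-interval⇒complement {c} c∈ with 1≤c , c<2+k ← ∈-interval⁻ c∈ =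
    ∸-monoʳ-< 1≤c c≤N ,
    subst (_≤ N ∸ c) (m+n∸n≡m 3 k) (∸-monoʳ-≤ N (≤-pred c<2+k)) ,
    m∸[m∸n]≡n c≤N
    where
    c≤N : c ≤ N
    c≤N = ≤-trans (≤-pred c<2+k) (m≤n+m (suc k) 3)

  digit : Map N → Fin (sizeA N) → ℕ
  digit v i = toℕ (elA N i ⊕ Vec.lookup v i)

  digitsOf : Map N → List ℕ
  digitsOf v = tabulate (digit v)

  complement : Map N → Fin (sizeA N) → ℕ
  complement v i = N ∸ toℕ (Vec.lookup v i)

  complements : Map N → List ℕ
  complements v = tabulate (complement v)

  digit-≡ : ∀ v i → digit v i ≡ (position (toℕ i) + toℕ (Vec.lookup v i)) % N
  digit-≡ v i = trans (toℕ-fromℕ< _) (cong (λ a → (a + toℕ (Vec.lookup v i)) % N) (toℕ-elA i))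

  matching-digit : ∀ {v} → IsMatching N v → ∀ i →
    Digit (digit v i) × position (toℕ i) ∸ digit v i ≡ N ∸ toℕ (Vec.lookup v i)
  matching-digit {v} (inB , _ , _ , notA) i = δ , (begin
    position (toℕ i) ∸ digit v i
      ≡⟨ cong (position (toℕ i) ∸_) (digit-≡ v i) ⟩
    position (toℕ i) ∸ (position (toℕ i) + toℕ (Vec.lookup v i)) % N
      ≡⟨ m∸[m+n]%o≡o∸n (proj₁ bounds) (B⇒3≤ (inB i)) (proj₂ bounds) (toℕ<n _)
                       (subst Digit (digit-≡ v i) δ) ⟩
    N ∸ toℕ (Vec.lookup v i) ∎)
    where
    δ : Digit (digit v i)
    δ = not-A⇒digit (digit v i) (notA i)
    bounds : 2 ≤ position (toℕ i) × position (toℕ i) < N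
    bounds = position-bounds (toℕ<1+k i)

  complements-↭⇒matching : ∀ v → complements v ↭ interval 1 (suc k) →
    (∀ i → ¬ InA (elA N i ⊕ Vec.lookup v i)) → IsMatching N v
  complements-↭⇒matching v σ not-A = inB , injective , surjective , not-A
    where
    inB : ∀ i → InB (Vec.lookup v i)
    inB i
      with _ , 3≤ , _ ← ∈-interval⇒complement (∈-resp-↭ σ (∈-tabulate⁺ {f = complement v} i)) =
      3≤⇒B (subst (3 ≤_) (m∸[m∸n]≡n (<⇒≤ (toℕ<n (Vec.lookup v i)))) 3≤)
    injective : ∀ i j → Vec.lookup v i ≡ Vec.lookup v j → i ≡ j
    injective i j vᵢ≡vⱼ =
      tabulate-unique⇒injective (Unique-resp-↭ (↭-sym σ) (interval-unique 1 (suc k)))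
        (cong (λ b → N ∸ toℕ b) vᵢ≡vⱼ)
    surjective : ∀ b → InB b → ∃ λ i → Vec.lookup v i ≡ b
    surjective b b∈B
      with i , N∸b≡ ← ∈-tabulate⁻ {f = complement v}
                        (∈-resp-↭ (↭-sym σ) (complement-∈-interval (B⇒3≤ b∈B) (toℕ<n b))) =
      i , toℕ-injective (sym (∸-cancelˡ-≡ (<⇒≤ (toℕ<n b)) (<⇒≤ (toℕ<n _)) N∸b≡))

  matching⇒complements-↭ : ∀ {v} → IsMatching N v → complements v ↭ interval 1 (suc k)
  matching⇒complements-↭ {v} (inB , injective , surjective , _) =
    unique-⊆⊇⇒↭ (Unique.tabulate⁺ complement-injective) (interval-unique 1 (suc k)) ⊆ ⊇
    where
    complement-injective : ∀ {i j} → complement v i ≡ complement v j → i ≡ j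
    complement-injective eq =
      injective _ _ (toℕ-injective (∸-cancelˡ-≡ (<⇒≤ (toℕ<n _)) (<⇒≤ (toℕ<n _)) eq))
    ⊆ : ∀ {c} → c ∈ complements v → c ∈ interval 1 (suc k)
    ⊆ c∈ with i , refl ← ∈-tabulate⁻ {f = complement v} c∈ =
      complement-∈-interval (B⇒3≤ (inB i)) (toℕ<n _)
    ⊇ : ∀ {c} → c ∈ interval 1 (suc k) → c ∈ complements v
    ⊇ {c} c∈ with N∸c<N , 3≤N∸c , N∸[N∸c]≡c ← ∈-interval⇒complement c∈
      with i , vᵢ≡ ← surjective (fromℕ< N∸c<N) (3≤⇒B (subst (3 ≤_) (sym (toℕ-fromℕ< N∸c<N)) 3≤N∸c)) =
      subst (_∈ complements v) complementᵢ≡c (∈-tabulate⁺ {f = complement v} i)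
      where
      complementᵢ≡c : complement v i ≡ c
      complementᵢ≡c =
        trans (cong (λ b → N ∸ toℕ b) vᵢ≡) (trans (cong (N ∸_) (toℕ-fromℕ< N∸c<N)) N∸[N∸c]≡c)

  length-digitsOf : ∀ v → length (digitsOf v) ≡ suc k
  length-digitsOf v = trans (length-tabulate (digit v)) sizeA-≡

  matching⇒valid : ∀ {v} → IsMatching N v → Valid (digitsOf v)
  matching⇒valid {v} M =
    tabulate⁺ (proj₁ ∘ matching-digit {v} M) ,
    subst₂ (λ xs l → xs ↭ interval 1 l) (sym images≡complements) (sym (length-digitsOf v))
      (matching⇒complements-↭ {v} M)
    where
    images≡complements : images (digitsOf v) ≡ complements v
    images≡complements =
      trans (images-tabulate (digit v)) (tabulate-cong (proj₂ ∘ matching-digit {v} M))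

  imageAt : List ℕ → Fin (sizeA N) → ℕ
  imageAt ds i = position (toℕ i) ∸ nth ds (toℕ i)

  -- Reducing mod N only makes encode total; on valid words N ∸ imageAt ds i is already below N.
  encode : List ℕ → Map N
  encode ds = Vec.tabulate (λ i → (N ∸ imageAt ds i) mod N)

  encode-digitsOf : ∀ {v} → IsMatching N v → encode (digitsOf v) ≡ v
  encode-digitsOf {v} M = trans (Vec.tabulate-cong pointwise) (Vec.tabulate∘lookup v)
    where
    pointwise : ∀ i → (N ∸ imageAt (digitsOf v) i) mod N ≡ Vec.lookup v i
    pointwise i = toℕ-injective (begin
      toℕ ((N ∸ imageAt (digitsOf v) i) mod N)
        ≡⟨ toℕ-fromℕ< _ ⟩
      (N ∸ (position (toℕ i) ∸ nth (digitsOf v) (toℕ i))) % N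
        ≡⟨ cong (λ d → (N ∸ (position (toℕ i) ∸ d)) % N) (nth-tabulate (digit v) i) ⟩
      (N ∸ (position (toℕ i) ∸ digit v i)) % N
        ≡⟨ cong (λ c → (N ∸ c) % N) (proj₂ (matching-digit {v} M i)) ⟩
      (N ∸ (N ∸ toℕ (Vec.lookup v i))) % N
        ≡⟨ cong (_% N) (m∸[m∸n]≡n (<⇒≤ (toℕ<n (Vec.lookup v i)))) ⟩
      toℕ (Vec.lookup v i) % N
        ≡⟨ m<n⇒m%n≡m (toℕ<n (Vec.lookup v i)) ⟩
      toℕ (Vec.lookup v i) ∎)

  weight≡count : ∀ j v → weight N j v ≡ count j (digitsOf v)
  weight≡count j v = sym (trans (cong (count j) (sym (map-tabulate id (digit v))))
                                (length-filter-map (_≟ j) (digit v) (List.allFin (sizeA N))))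

  module Encoding {ds} (valid : Valid ds) (length≡ : length ds ≡ suc k) where

    tabulate-digits : tabulate (λ (i : Fin (sizeA N)) → nth ds (toℕ i)) ≡ ds
    tabulate-digits = tabulate-nth ds (trans length≡ (sym sizeA-≡))

    digit-at : ∀ i → Digit (nth ds (toℕ i))
    digit-at = tabulate⁻ (subst (All Digit) (sym tabulate-digits) (proj₁ valid))

    images≡ : images ds ≡ tabulate (imageAt ds)
    images≡ =
      trans (cong images (sym tabulate-digits)) (images-tabulate (λ i → nth ds (toℕ i)))

    image-∈ : ∀ i → imageAt ds i ∈ interval 1 (suc k)
    image-∈ i = subst (λ l → imageAt ds i ∈ interval 1 l) length≡
      (∈-resp-↭ (proj₂ valid) (subst (imageAt ds i ∈_) (sym images≡) (∈-tabulate⁺ {f = imageAt ds} i)))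

    toℕ-encode : ∀ i → toℕ (Vec.lookup (encode ds) i) ≡ N ∸ imageAt ds i
    toℕ-encode i = trans (cong toℕ (Vec.lookup∘tabulate (λ j → (N ∸ imageAt ds j) mod N) i))
      (trans (toℕ-fromℕ< _) (m<n⇒m%n≡m (proj₁ (∈-interval⇒complement (image-∈ i)))))

    complements-encode : complements (encode ds) ≡ images ds
    complements-encode = trans (tabulate-cong complementᵢ≡) (sym images≡)
      where
      complementᵢ≡ : ∀ i → complement (encode ds) i ≡ imageAt ds i
      complementᵢ≡ i =
        trans (cong (N ∸_) (toℕ-encode i)) (proj₂ (proj₂ (∈-interval⇒complement (image-∈ i))))

    digit-encode : ∀ i → digit (encode ds) i ≡ nth ds (toℕ i)
    digit-encode i = begin
      digit (encode ds) i                      ≡⟨ digit-≡ (encode ds) i ⟩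
      (p + toℕ (Vec.lookup (encode ds) i)) % N ≡⟨ cong (λ b → (p + b) % N) (toℕ-encode i) ⟩
      (p + (N ∸ c)) % N                        ≡⟨ cong (λ a → (a + (N ∸ c)) % N) (m∸n+n≡m d≤p) ⟨
      (c + d + (N ∸ c)) % N                    ≡⟨ cong (_% N) (rearrange c d (N ∸ c)) ⟩
      (d + (c + (N ∸ c))) % N                  ≡⟨ cong (λ x → (d + x) % N) (m+[n∸m]≡n c≤N) ⟩
      (d + N) % N                              ≡⟨ [m+n]%n≡m%n d N ⟩
      d % N                                    ≡⟨ m<n⇒m%n≡m d<N ⟩
      d                                        ∎
      where
      p d c : ℕ
      p = position (toℕ i)
      d = nth ds (toℕ i)
      c = imageAt ds i
      c∈ : 1 ≤ c × c < 2 + k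
      c∈ = ∈-interval⁻ (image-∈ i)
      d<N : d < N
      d<N = ≤-trans (s≤s (digit≤3 (digit-at i))) (m≤m+n 4 k)
      d≤p : d ≤ p
      d≤p = <⇒≤ (m∸n≢0⇒n<m (≢-sym (<⇒≢ (proj₁ c∈))))
      c≤N : c ≤ N
      c≤N = ≤-trans (≤-pred (proj₂ c∈)) (m≤n+m (suc k) 3)
      rearrange : ∀ x y z → x + y + z ≡ y + (x + z)
      rearrange = solve-∀

    digitsOf-encode : digitsOf (encode ds) ≡ ds
    digitsOf-encode = trans (tabulate-cong digit-encode) tabulate-digits

    complements-encode-↭ : complements (encode ds) ↭ interval 1 (suc k)
    complements-encode-↭ =
      subst₂ (λ xs l → xs ↭ interval 1 l) (sym complements-encode) length≡ (proj₂ valid)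

    weight-encode : ∀ j → weight N j (encode ds) ≡ count j ds
    weight-encode j = trans (weight≡count j (encode ds)) (cong (count j) digitsOf-encode)

    encode-matching : IsMatching N (encode ds)
    encode-matching = complements-↭⇒matching (encode ds) complements-encode-↭
      (λ i → digit⇒not-A (subst Digit (sym (digit-encode i)) (digit-at i)))

  Conditions : ℕ → ℕ → ℕ → Set
  Conditions w₀ w₁ w₃ = w₀ + w₁ + w₃ ≡ N ∸ 3 × 2 * w₀ + w₁ + 1 ≡ w₃ + 2

  conditions? : ∀ w₀ w₁ w₃ → Dec (Conditions w₀ w₁ w₃)
  conditions? w₀ w₁ w₃ = (w₀ + w₁ + w₃ ≟ N ∸ 3) ×-dec (2 * w₀ + w₁ + 1 ≟ w₃ + 2)

  conditions-resp : ∀ {c₀ c₁ c₃ w₀ w₁ w₃} → c₀ ≡ w₀ → c₁ ≡ w₁ → c₃ ≡ w₃ →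
    Conditions c₀ c₁ c₃ → Conditions w₀ w₁ w₃
  conditions-resp refl refl refl c = c

  conditions⇒0<w₀+w₁ : ∀ w₀ w₁ w₃ → Conditions w₀ w₁ w₃ → 0 < w₀ + w₁
  conditions⇒0<w₀+w₁ zero zero w₃ (_ , 1≡w₃+2) with () ← suc-injective (trans 1≡w₃+2 (+-comm w₃ 2))
  conditions⇒0<w₀+w₁ zero (suc _) _ _ = s≤s z≤n
  conditions⇒0<w₀+w₁ (suc _) _ _ _ = s≤s z≤n

  admissible-conditions : ∀ {ds} → Admissible ds → length ds ≡ suc k →
    Conditions (count 0 ds) (count 1 ds) (count 3 ds)
  admissible-conditions α length≡ =
    trans (count-digits (proj₁ (admissible⇒valid α))) length≡ , admissible-balance α

  matching⇒admissible : ∀ {v} → IsMatching N v → Admissible (digitsOf v)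
  matching⇒admissible {v} M =
    valid⇒admissible (subst (0 <_) (sym (length-digitsOf v)) (s≤s z≤n)) (matching⇒valid {v} M)

  encodings : ℕ → ℕ → List (Map N)
  encodings w₀ w₁ = map encode (admissibles w₀ w₁)

  module _ (w₀ w₁ w₃ : ℕ) where

    MatchingWith : Map N → Set
    MatchingWith v = IsMatching N v × weight N 0 v ≡ w₀ × weight N 1 v ≡ w₁ × weight N 3 v ≡ w₃

    matchingWith⇒conditions : ∀ {v} → MatchingWith v → Conditions w₀ w₁ w₃
    matchingWith⇒conditions {v} (M , w₀≡ , w₁≡ , w₃≡) =
      conditions-resp (count≡ 0 w₀≡) (count≡ 1 w₁≡) (count≡ 3 w₃≡)
        (admissible-conditions (matching⇒admissible {v} M) (length-digitsOf v))
      where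
      count≡ : ∀ j {w} → weight N j v ≡ w → count j (digitsOf v) ≡ w
      count≡ j wⱼ≡ = trans (sym (weight≡count j v)) wⱼ≡

    ∈-admissibles⇒valid : ∀ {ds} → Conditions w₀ w₁ w₃ → ds ∈ admissibles w₀ w₁ →
      Valid ds × length ds ≡ suc k × count 0 ds ≡ w₀ × count 1 ds ≡ w₁ × count 3 ds ≡ w₃
    ∈-admissibles⇒valid {ds} (sum≡ , balance≡) ds∈ with α , c₀≡ , c₁≡ ← ∈-admissibles⁻ w₀ w₁ ds∈ =
      admissible⇒valid α , length≡ , c₀≡ , c₁≡ , c₃≡
      where
      c₃≡ : count 3 ds ≡ w₃
      c₃≡ = +-cancelʳ-≡ 2 _ _ (trans (sym (admissible-balance α))
              (trans (cong₂ (λ a b → 2 * a + b + 1) c₀≡ c₁≡) balance≡))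
      length≡ : length ds ≡ suc k
      length≡ = trans (sym (count-digits (proj₁ (admissible⇒valid α))))
        (trans (cong₂ (λ a b → a + b + count 3 ds) c₀≡ c₁≡) (trans (cong (w₀ + w₁ +_) c₃≡) sum≡))

    encode-matchingWith : ∀ {ds} → Conditions w₀ w₁ w₃ → ds ∈ admissibles w₀ w₁ →
      MatchingWith (encode ds)
    encode-matchingWith c ds∈ =
      let valid , length≡ , c₀≡ , c₁≡ , c₃≡ = ∈-admissibles⇒valid c ds∈
          open Encoding valid length≡
      in encode-matching , trans (weight-encode 0) c₀≡ , trans (weight-encode 1) c₁≡ ,
         trans (weight-encode 3) c₃≡

    ∈-encodings⁻ : ∀ {v} → Conditions w₀ w₁ w₃ → v ∈ encodings w₀ w₁ → MatchingWith v
    ∈-encodings⁻ c v∈ =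
      let _ , ds∈ , v≡ = ∈-map⁻ encode v∈ in subst MatchingWith (sym v≡) (encode-matchingWith c ds∈)

    ∈-encodings⁺ : ∀ {v} → MatchingWith v → v ∈ encodings w₀ w₁
    ∈-encodings⁺ {v} (M , w₀≡ , w₁≡ , _) =
      subst (_∈ encodings w₀ w₁) (encode-digitsOf {v} M)
        (∈-map⁺ encode (subst₂ (λ c₀ c₁ → digitsOf v ∈ admissibles c₀ c₁)
          (trans (sym (weight≡count 0 v)) w₀≡) (trans (sym (weight≡count 1 v)) w₁≡)
          (∈-admissibles⁺ (matching⇒admissible {v} M))))

    encodings-unique : Conditions w₀ w₁ w₃ → Unique (encodings w₀ w₁)
    encodings-unique c =
      Unique.map⁻ {f = digitsOf} (subst Unique (sym digitsOf∘encode) (admissibles-unique w₀ w₁))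
      where
      digitsOf∘encode : map digitsOf (encodings w₀ w₁) ≡ admissibles w₀ w₁
      digitsOf∘encode = trans (sym (map-∘ (admissibles w₀ w₁))) (map-id-local (All.tabulate λ ds∈ →
        let valid , length≡ , _ = ∈-admissibles⇒valid c ds∈ in Encoding.digitsOf-encode valid length≡))

    Enumeration : Set
    Enumeration = ∃ λ (L : List (Map N)) →
      Unique L ×
      (∀ v → (v ∈ L) ⇔ MatchingWith v) ×
      (Conditions w₀ w₁ w₃ → length L ≡ (w₀ + w₁) C w₁) ×
      (¬ Conditions w₀ w₁ w₃ → length L ≡ 0)

    empty-enumeration : ¬ Conditions w₀ w₁ w₃ → Enumeration
    empty-enumeration ¬c =
      [] , [] , (λ v → mk⇔ (λ ()) (⊥-elim ∘ ¬c ∘ matchingWith⇒conditions {v})) , ⊥-elim ∘ ¬c , λ _ → refl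

    encodings-enumeration : Conditions w₀ w₁ w₃ → Enumeration
    encodings-enumeration c =
      encodings w₀ w₁ , encodings-unique c , (λ _ → mk⇔ (∈-encodings⁻ c) ∈-encodings⁺) ,
      (λ _ → trans (length-map encode (admissibles w₀ w₁))
                   (length-admissibles w₀ w₁ (conditions⇒0<w₀+w₁ w₀ w₁ w₃ c))) ,
      (λ ¬c → ⊥-elim (¬c c))

    matchings-with-weights : Enumeration
    matchings-with-weights = decide (conditions? w₀ w₁ w₃)
      where
      decide : Dec (Conditions w₀ w₁ w₃) → Enumeration
      decide (yes c) = encodings-enumeration c
      decide (no ¬c) = empty-enumeration ¬c

lemma2p4 : (n : ℕ) → 6 ≤ n → (w₀ w₁ w₃ : ℕ) →
    ∃ λ (L : List (Map n)) →
    Unique L ×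
    (∀ (v : Map n) → (v ∈ L) ⇔
    (IsMatching n v × weight n 0 v ≡ w₀ × weight n 1 v ≡ w₁ × weight n 3 v ≡ w₃)) ×
    ((w₀ + w₁ + w₃ ≡ n ∸ 3 × 2 * w₀ + w₁ + 1 ≡ w₃ + 2) → length L ≡ (w₀ + w₁) C w₁) ×
    (¬ (w₀ + w₁ + w₃ ≡ n ∸ 3 × 2 * w₀ + w₁ + 1 ≡ w₃ + 2) → length L ≡ 0)
lemma2p4 (suc (suc (suc (suc k)))) (s≤s (s≤s (s≤s (s≤s _)))) = Matchings.matchings-with-weights k
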